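{- Let $(a_p)_p$ be a sequence of integers indexed by the primes $p$ such that $a_p\to\infty$ as $p\to\infty$ and, for every positive integer $d$, $a_p^d=o(p)$ as $p\to\infty$. Then $(a_p\bmod p)_p\in\mathcal{A}\setminus\mathcal{C}_{\mathcal{A}}$.
   Context: $\mathcal{A}\coloneqq\bigl(\prod_{p}\mathbb{Z}/p\mathbb{Z}\bigr)/\bigl(\bigoplus_{p}\mathbb{Z}/p\mathbb{Z}\bigr)$, the product and sum over all primes $p$. An element of $\mathcal{A}$ is written $(a_p)_p$ (or $(a_p\bmod p)_p$ for integers or $p$-integral rationals $a_p$); it suffices that $a_p$ be given for all sufficiently large $p$, and two elements are equal iff their components agree for all but finitely many primes. The field $\mathbb{Q}$ embeds diagonally in $\mathcal{A}$ via $r\mapsto(r\bmod p)_p$. $\mathcal{C}_{\mathcal{A}}$ denotes the integral closure of $\mathbb{Q}$ in $\mathcal{A}$; equivalently, $\alpha=(a_p)_p\in\mathcal{C}_{\mathcal{A}}$ iff there is a nonzero polynomial $f\in\mathbb{Z}[x]$ with $f(\alpha)=0$ in $\mathcal{A}$, i.e. $f(a_p)\equiv0\pmod p$ for all but finitely many primes $p$. -}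

module Defs where

open import Data.Nat as ℕ using (ℕ; suc)
open import Data.Nat.Primality using (Prime)
open import Data.Integer as ℤ using (ℤ; +_; ∣_∣)
open import Data.Integer.Divisibility using () renaming (_∣_ to _∣ℤ_)
open import Data.List using (List; []; _∷_)
open import Data.List.Relation.Unary.Any using (Any)
open import Data.Product using (Σ; ∃; _×_)
open import Relation.Binary.PropositionalEquality using (_≢_)

-- A "sequence indexed by the primes" is represented by a function ℕ → ℤ,
-- of which only the values at primes are ever used.

AllButFinitelyManyPrimes : (ℕ → Set) → Set
AllButFinitelyManyPrimes P = ∃ λ N → (p : ℕ) → Prime p → N ℕ.≤ p → P p

-- Polynomials in ℤ[x] as coefficient lists [c₀, c₁, …, cₙ] (constant term first).
Poly : Set
Poly = List ℤ

eval : Poly → ℤ → ℤ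
eval []       x = + 0
eval (c ∷ cs) x = c ℤ.+ x ℤ.* eval cs x

NonZeroPoly : Poly → Set
NonZeroPoly f = Any (λ c → c ≢ + 0) f

-- membership of the element (a_p mod p)_p of 𝒜 in the integral closure 𝒞_𝒜:
-- some nonzero f ∈ ℤ[x] has f(a_p) ≡ 0 (mod p) for all but finitely many primes p.
InC𝒜 : (ℕ → ℤ) → Set
InC𝒜 a = Σ Poly λ f → NonZeroPoly f ×
           AllButFinitelyManyPrimes (λ p → (+ p) ∣ℤ eval f (a p))

TendsToInfinity : (ℕ → ℤ) → Set
TendsToInfinity a = (M : ℤ) → AllButFinitelyManyPrimes (λ p → M ℤ.≤ a p)

-- a_p^d = o(p): for every ε = 1/k (k ≥ 1), eventually |a_p^d| ≤ p / k,
-- i.e. k * |a_p|^d ≤ p.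
LittleOhP : ℕ → (ℕ → ℤ) → Set
LittleOhP d a = (k : ℕ) → 1 ℕ.≤ k →
  AllButFinitelyManyPrimes (λ p → k ℕ.* (∣ a p ∣ ℕ.^ d) ℕ.≤ p)

{-# OPTIONS --safe #-}
-- A nonzero f ∈ ℤ[x] is eventually nonzero and satisfies |f(x)| ≤ C |x|^n with
-- n = length f and C the sum of the absolute values of its coefficients. Were
-- p ∣ f(a_p) for almost all p, pick a prime p so large that f(a_p) ≠ 0 and
-- (C + 1) |a_p|^n ≤ p: then p ≤ |f(a_p)| ≤ C |a_p|^n < p.
module Submission where

open import Defs
open import Data.Nat using (ℕ; _≤_; suc; _+_; _*_; _^_; _<_; _⊔_; _!; z≤n; s≤s; NonZero; >-nonZero)
open import Data.Integer using (ℤ)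
open import Relation.Nullary using (¬_; yes; no; ¬?; contradiction)

open import Data.Nat.Properties
open import Data.Nat.Divisibility using (∣-trans; m∣m*n; ∣⇒≤; ∣1⇒≡1; ∣m+n∣m⇒∣n; m≤n⇒m!∣n!)
  renaming (_∣_ to _∣ℕ_)
open import Data.Nat.ListAction using (product)
open import Data.Nat.Primality using (Prime; ¬prime[1]; prime⇒nonZero)
open import Data.Nat.Primality.Factorisation using (factorise)
open import Data.Integer as ℤ using (+≤+; 0ℤ; ∣_∣)
import Data.Integer.Properties as ℤₚ
open import Algebra.Properties.AbelianGroup ℤₚ.+-0-abelianGroup using (inverseʳ-unique)
open import Data.List using ([]; _∷_; length)
open import Data.List.Relation.Unary.Any using (here; there; any?)
open import Data.List.Relation.Unary.All using ([]; _∷_)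
open import Data.Product using (∃; _×_; _,_)
open import Function using (_∘_)
open import Relation.Unary using (Decidable)
open import Relation.Binary.PropositionalEquality

m∣n! : ∀ {m n} .{{_ : NonZero m}} → m ≤ n → m ∣ℕ n !
m∣n! {suc k} m≤n = ∣-trans (m∣m*n (k !)) (m≤n⇒m!∣n! m≤n)

∃prime-divisor : ∀ {n} → 2 ≤ n → ∃ λ p → Prime p × p ∣ℕ n
∃prime-divisor {n} 2≤n with factorise n {{>-nonZero (<⇒≤ 2≤n)}}
... | record { factors = [] ; isFactorisation = n≡1 } = contradiction n≡1 (>⇒≢ 2≤n)
... | record { factors = p ∷ ps ; isFactorisation = n≡p*ps ; factorsPrime = p-prime ∷ _ } =
  p , p-prime , subst (p ∣ℕ_) (sym n≡p*ps) (m∣m*n (product ps))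

∃prime≥ : ∀ n → ∃ λ p → Prime p × n ≤ p
∃prime≥ n with ∃prime-divisor (+-monoˡ-≤ 1 (1≤n! n))
... | p , p-prime , p∣n!+1 with p ≤? n
...   | no p≰n = p , p-prime , ≰⇒≥ p≰n
...   | yes p≤n = contradiction (subst Prime (∣1⇒≡1 p∣1) p-prime) ¬prime[1]
  where
  p∣1 : p ∣ℕ 1
  p∣1 = ∣m+n∣m⇒∣n p∣n!+1 (m∣n! {{prime⇒nonZero p-prime}} p≤n)

module _ {P Q : ℕ → Set} where

  allButFinitelyManyPrimes-map : (∀ {p} → P p → Q p) →
    AllButFinitelyManyPrimes P → AllButFinitelyManyPrimes Q
  allButFinitelyManyPrimes-map P⇒Q (N , P≥N) = N , λ p p-prime N≤p → P⇒Q (P≥N p p-prime N≤p)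

  allButFinitelyManyPrimes-× : AllButFinitelyManyPrimes P → AllButFinitelyManyPrimes Q →
    AllButFinitelyManyPrimes (λ p → P p × Q p)
  allButFinitelyManyPrimes-× (M , P≥M) (N , Q≥N) = M ⊔ N , λ p p-prime M⊔N≤p →
    P≥M p p-prime (m⊔n≤o⇒m≤o M N M⊔N≤p) , Q≥N p p-prime (m⊔n≤o⇒n≤o M N M⊔N≤p)

allButFinitelyManyPrimes⇒∃ : ∀ {P} → AllButFinitelyManyPrimes P → ∃ λ p → Prime p × P p
allButFinitelyManyPrimes⇒∃ (N , P≥N) with ∃prime≥ N
... | p , p-prime , N≤p = p , p-prime , P≥N p p-prime N≤p

nonZeroPoly? : Decidable NonZeroPoly
nonZeroPoly? = any? (λ c → ¬? (c ℤ.≟ 0ℤ))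

nonZeroPoly⇒1≤length : ∀ {f} → NonZeroPoly f → 1 ≤ length f
nonZeroPoly⇒1≤length (here _)  = s≤s z≤n
nonZeroPoly⇒1≤length (there _) = s≤s z≤n

‖_‖₁ : Poly → ℕ
‖ [] ‖₁     = 0
‖ c ∷ cs ‖₁ = ∣ c ∣ + ‖ cs ‖₁

∣eval∣≤∣x∣^length*‖f‖₁ : ∀ f x .{{_ : ℤ.NonZero x}} → ∣ eval f x ∣ ≤ ∣ x ∣ ^ length f * ‖ f ‖₁
∣eval∣≤∣x∣^length*‖f‖₁ []       x = z≤n
∣eval∣≤∣x∣^length*‖f‖₁ (c ∷ cs) x = begin
  ∣ c ℤ.+ x ℤ.* e ∣                      ≤⟨ ℤₚ.∣i+j∣≤∣i∣+∣j∣ c (x ℤ.* e) ⟩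
  ∣ c ∣ + ∣ x ℤ.* e ∣                    ≡⟨ cong (∣ c ∣ +_) (ℤₚ.∣i*j∣≡∣i∣*∣j∣ x e) ⟩
  ∣ c ∣ + ∣ x ∣ * ∣ e ∣                  ≤⟨ +-mono-≤ (m≤n*m ∣ c ∣ (∣ x ∣ * X) {{m^n≢0 ∣ x ∣ (suc n)}})
                                                     (*-monoʳ-≤ ∣ x ∣ (∣eval∣≤∣x∣^length*‖f‖₁ cs x)) ⟩
  ∣ x ∣ * X * ∣ c ∣ + ∣ x ∣ * (X * C)    ≡⟨ cong (∣ x ∣ * X * ∣ c ∣ +_) (*-assoc ∣ x ∣ X C) ⟨
  ∣ x ∣ * X * ∣ c ∣ + ∣ x ∣ * X * C      ≡⟨ *-distribˡ-+ (∣ x ∣ * X) ∣ c ∣ C ⟨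
  ∣ x ∣ * X * (∣ c ∣ + C)                ∎
  where
  open ≤-Reasoning
  e = eval cs x
  n = length cs
  X = ∣ x ∣ ^ n
  C = ‖ cs ‖₁

∣i∣<∣j∣⇒i+j≢0 : ∀ i j → ∣ i ∣ < ∣ j ∣ → i ℤ.+ j ≢ 0ℤ
∣i∣<∣j∣⇒i+j≢0 i j ∣i∣<∣j∣ i+j≡0 =
  <-irrefl (sym (trans (cong ∣_∣ (inverseʳ-unique i j i+j≡0)) (ℤₚ.∣-i∣≡∣i∣ i))) ∣i∣<∣j∣

eval-zeroPoly : ∀ {f} → ¬ NonZeroPoly f → ∀ x → eval f x ≡ 0ℤ
eval-zeroPoly {[]}     _   x = refl
eval-zeroPoly {c ∷ cs} f≡0 x with c ℤ.≟ 0ℤ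
... | no c≢0  = contradiction (here c≢0) f≡0
... | yes refl = begin
  0ℤ ℤ.+ x ℤ.* eval cs x ≡⟨ ℤₚ.+-identityˡ _ ⟩
  x ℤ.* eval cs x        ≡⟨ cong (x ℤ.*_) (eval-zeroPoly (f≡0 ∘ there) x) ⟩
  x ℤ.* 0ℤ               ≡⟨ ℤₚ.*-zeroʳ x ⟩
  0ℤ                     ∎
  where open ≡-Reasoning

eval≢0-eventually : ∀ {f} → NonZeroPoly f → ∃ λ M → ∀ x → M ≤ ∣ x ∣ → eval f x ≢ 0ℤ
eval≢0-eventually {c ∷ cs} f≢0 with nonZeroPoly? cs | f≢0
... | no cs≡0   | there cs≢0 = contradiction cs≢0 cs≡0
... | no cs≡0   | here c≢0   = 0 , λ x _ → c≢0 ∘ trans (sym (eval-const x))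
  where
  eval-const : ∀ x → eval (c ∷ cs) x ≡ c
  eval-const x = begin
    c ℤ.+ x ℤ.* eval cs x ≡⟨ cong (λ e → c ℤ.+ x ℤ.* e) (eval-zeroPoly cs≡0 x) ⟩
    c ℤ.+ x ℤ.* 0ℤ        ≡⟨ cong (λ e → c ℤ.+ e) (ℤₚ.*-zeroʳ x) ⟩
    c ℤ.+ 0ℤ              ≡⟨ ℤₚ.+-identityʳ c ⟩
    c                     ∎
    where open ≡-Reasoning
... | yes cs≢0 | _ with eval≢0-eventually cs≢0
...   | M , eval-cs≢0 = M ⊔ suc ∣ c ∣ , λ x M⊔[1+∣c∣]≤∣x∣ →
  ∣i∣<∣j∣⇒i+j≢0 c (x ℤ.* eval cs x) (∣c∣<∣x*eval-cs∣ x M⊔[1+∣c∣]≤∣x∣)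
  where
  ∣c∣<∣x*eval-cs∣ : ∀ x → M ⊔ suc ∣ c ∣ ≤ ∣ x ∣ → ∣ c ∣ < ∣ x ℤ.* eval cs x ∣
  ∣c∣<∣x*eval-cs∣ x M⊔[1+∣c∣]≤∣x∣ = begin-strict
    ∣ c ∣                   <⟨ m⊔n≤o⇒n≤o M _ M⊔[1+∣c∣]≤∣x∣ ⟩
    ∣ x ∣                   ≤⟨ m≤m*n ∣ x ∣ ∣ e ∣ {{ℤ.≢-nonZero (eval-cs≢0 x (m⊔n≤o⇒m≤o M _ M⊔[1+∣c∣]≤∣x∣))}} ⟩
    ∣ x ∣ * ∣ e ∣           ≡⟨ ℤₚ.∣i*j∣≡∣i∣*∣j∣ x e ⟨
    ∣ x ℤ.* e ∣             ∎
    where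
    open ≤-Reasoning
    e = eval cs x

p∤eval : ∀ f x {p} .{{_ : ℤ.NonZero x}} → eval f x ≢ 0ℤ →
  suc ‖ f ‖₁ * ∣ x ∣ ^ length f ≤ p → ¬ p ∣ℕ ∣ eval f x ∣
p∤eval f x {p} f[x]≢0 small p∣f[x] = <-irrefl refl (begin-strict
  p                   ≤⟨ ∣⇒≤ {{ℤ.≢-nonZero f[x]≢0}} p∣f[x] ⟩
  ∣ eval f x ∣        ≤⟨ ∣eval∣≤∣x∣^length*‖f‖₁ f x ⟩
  X * ‖ f ‖₁          <⟨ *-monoʳ-< X (n<1+n ‖ f ‖₁) ⟩
  X * suc ‖ f ‖₁      ≡⟨ *-comm X (suc ‖ f ‖₁) ⟩
  suc ‖ f ‖₁ * X      ≤⟨ small ⟩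
  p                   ∎)
  where
  open ≤-Reasoning
  X = ∣ x ∣ ^ length f
  instance
    X≢0 : NonZero X
    X≢0 = m^n≢0 ∣ x ∣ (length f)

+m≤i⇒m≤∣i∣ : ∀ {m i} → ℤ.+ m ℤ.≤ i → m ≤ ∣ i ∣
+m≤i⇒m≤∣i∣ (+≤+ m≤n) = m≤n

lemma2p3 : (a : ℕ → ℤ) → TendsToInfinity a →
    ((d : ℕ) → 1 ≤ d → LittleOhP d a) →
    ¬ InC𝒜 a
lemma2p3 a a→∞ aᵈ=o[p] (f , f≢0 , p∣f[aₚ]) =
  let (M , f[x]≢0) = eval≢0-eventually f≢0
      ∣aₚ∣>M = allButFinitelyManyPrimes-map +m≤i⇒m≤∣i∣ (a→∞ (ℤ.+ suc M))
      aₚ-small = aᵈ=o[p] (length f) (nonZeroPoly⇒1≤length f≢0) (suc ‖ f ‖₁) (s≤s z≤n)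
      (p , _ , p∣f[aₚ] , M<∣aₚ∣ , [1+C]∣aₚ∣ⁿ≤p) = allButFinitelyManyPrimes⇒∃
        (allButFinitelyManyPrimes-× p∣f[aₚ] (allButFinitelyManyPrimes-× ∣aₚ∣>M aₚ-small))
  in  p∤eval f (a p) {{>-nonZero (≤-trans (s≤s z≤n) M<∣aₚ∣)}}
        (f[x]≢0 (a p) (<⇒≤ M<∣aₚ∣)) [1+C]∣aₚ∣ⁿ≤p p∣f[aₚ]
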